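{- Let $k,l$ be positive integers and $N$ a matroid. Then $N$ is an excluded minor for the class of almost $(k,l)$-uniform matroids if and only if $N\oplus U_{1,1}$ is an excluded minor for the class of almost $(k+1,l)$-uniform matroids.
   Context: $U_{1,1}$ is the matroid consisting of a single coloop. A matroid is $(k,l)$-uniform if it has no minor isomorphic to $U_{k,k}\oplus U_{0,l}$ ($k$ coloops and $l$ loops). A matroid $M$ is almost $(k,l)$-uniform if for every element $v$, at least one of $M-v$ or $M/v$ is $(k,l)$-uniform. An excluded minor for a class is a matroid not in the class all of whose proper minors belong to the class. -}

module Defs where

open import Data.Nat using (ℕ; zero; suc; _+_; _<_)
open import Data.Bool using (Bool; true; false; _∨_; if_then_else_)
open import Data.Fin using (Fin)
open import Data.Fin.Subset using (Subset; ⊥; _⊆_; ∣_∣; _∈_; _∉_; _∪_; ⁅_⁆)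
open import Data.Fin.Permutation using (Permutation; _⟨$⟩ʳ_)
open import Data.Vec using (Vec; []; _∷_; insertAt; drop; tabulate; lookup)
open import Data.Product using (Σ; _×_; ∃)
open import Data.Sum using (_⊎_)
open import Relation.Nullary using (¬_)
import Data.Empty as Empty
open import Data.Unit using (⊤)
open import Relation.Binary.PropositionalEquality using (_≡_)

Indep : ℕ → Set
Indep n = Subset n → Bool

record IsMatroid {n : ℕ} (I : Indep n) : Set where
  field
    empty-indep : I ⊥ ≡ true
    down-closed : ∀ (J K : Subset n) → J ⊆ K → I K ≡ true → I J ≡ true
    augment     : ∀ (J K : Subset n) → I J ≡ true → I K ≡ true → ∣ J ∣ < ∣ K ∣ →
                  ∃ λ x → x ∈ K × x ∉ J × I (J ∪ ⁅ x ⁆) ≡ true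

-- Deletion M - v : ground set E - v (reindexed by Fin n).
delete : ∀ {n} → Fin (suc n) → Indep (suc n) → Indep n
delete v I J = I (insertAt J v false)

-- Contraction M / v : if v is a loop, M / v = M - v; otherwise
-- J is independent in M / v iff J ∪ {v} is independent in M.
contract : ∀ {n} → Fin (suc n) → Indep (suc n) → Indep n
contract v I J =
  if I ⁅ v ⁆ then I (insertAt J v true) else I (insertAt J v false)

Iso : ∀ {m n} → Indep m → Indep n → Set
Iso {m} {n} M N =
  Σ (Permutation m n) λ σ →
    ∀ (J : Subset n) → N J ≡ M (tabulate (λ i → lookup J (σ ⟨$⟩ʳ i)))

data Minor {m : ℕ} (M : Indep m) : {n : ℕ} → Indep n → Set where
  iso : ∀ {n} {N : Indep n} → Iso M N → Minor M N
  del : ∀ {n} {N : Indep (suc n)} (v : Fin (suc n)) →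
        Minor M (delete v N) → Minor M N
  con : ∀ {n} {N : Indep (suc n)} (v : Fin (suc n)) →
        Minor M (contract v N) → Minor M N

ProperMinor : ∀ {m n} → Indep m → Indep n → Set
ProperMinor {n = zero} M N = Empty.⊥ -- the empty matroid has no proper minor
ProperMinor {n = suc n} M N =
  ∃ λ (v : Fin (suc n)) → Minor M (delete v N) ⊎ Minor M (contract v N)

isEmpty : ∀ {n} → Subset n → Bool
isEmpty [] = true
isEmpty (false ∷ J) = isEmpty J
isEmpty (true ∷ J) = false

-- U_{k,k} ⊕ U_{0,l}: ground set Fin (k + l); the first k elements
-- are coloops, the last l are loops.
UkkPlusU0l : (k l : ℕ) → Indep (k + l)
UkkPlusU0l k l J = isEmpty (drop k J)

-- N ⊕ U_{1,1}: new coloop added at position 0.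
plusColoop : ∀ {n} → Indep n → Indep (suc n)
plusColoop N (b ∷ J) = N J

Uniform : (k l : ℕ) → ∀ {n} → Indep n → Set
Uniform k l M = ¬ Minor (UkkPlusU0l k l) M

AlmostUniform : (k l : ℕ) → ∀ {n} → Indep n → Set
AlmostUniform k l {zero} M = ⊤
AlmostUniform k l {suc n} M =
  ∀ (v : Fin (suc n)) → Uniform k l (delete v M) ⊎ Uniform k l (contract v M)

InAlmostUniformClass : (k l : ℕ) → ∀ {n} → Indep n → Set
InAlmostUniformClass k l M = IsMatroid M × AlmostUniform k l M

ExcludedMinor : (C : ∀ {n} → Indep n → Set) → ∀ {n} → Indep n → Set
ExcludedMinor C N =
  IsMatroid N × ¬ C N × (∀ {m} (M : Indep m) → ProperMinor M N → C M)

{-# OPTIONS --safe #-}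
-- Write e for the new coloop and Uₖ for U_{k,k} ⊕ U_{0,l}. If a matroid Y has a minor U_{k+1}, following
-- the minor operations carries a coloop of U_{k+1} to a non-loop v of Y such that Uₖ is a minor of both
-- Y - v and Y / v, so Y is not almost (k,l)-uniform. Every minor of N ⊕ e is either a minor of N or
-- Y ⊕ e for a minor Y of N, and Y ⊕ e has a U_{k+1} minor only when Y has a Uₖ minor. Consequently
-- Y ⊕ e is almost (k+1,l)-uniform exactly when Y is almost (k,l)-uniform, which transfers both
-- excluded-minor conditions between N and N ⊕ e; the minors of N itself lie in the (k+1,l)-class
-- because every N - v is almost (k,l)-uniform.
module Submission where

open import Defs
open import Data.Bool using (Bool; true; false; _∨_; if_then_else_)
open import Data.Bool.Properties using (∨-identityʳ)
open import Data.Empty using (⊥-elim)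
open import Data.Fin using (Fin; zero; suc; punchIn; punchOut; _≟_)
open import Data.Fin.Permutation
  using (Permutation; _⟨$⟩ʳ_; _⟨$⟩ˡ_; inverseʳ; inverseˡ; remove; lift₀; flip; _∘ₚ_; punchIn-permute)
  renaming (id to idₚ)
open import Data.Fin.Properties using (punchInᵢ≢i; punchIn-punchOut)
open import Data.Fin.Subset using (Subset; ⊥; _⊆_; ∣_∣; _∈_; _∉_; _∪_; ⁅_⁆)
open import Data.Fin.Subset.Properties using (∪-identityʳ; drop-∷-⊆; drop-there; x∈⁅x⁆; x∈⁅y⁆⇒x≡y)
open import Data.Nat using (ℕ; zero; suc; _+_; _<_; _≥_; s≤s)
open import Data.Nat.Properties using (+-0-commutativeMonoid; <-trans; n<1+n)
open import Algebra.Properties.CommutativeMonoid.Sum +-0-commutativeMonoid using (sum; sum-permute; sum-cong-≗)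
open import Data.Product using (Σ-syntax; ∃; _×_; _,_)
open import Data.Sum using (_⊎_; inj₁; inj₂)
open import Data.Unit using (tt)
open import Data.Vec using (here; there; Vec; []; _∷_; insertAt; tabulate; lookup; replicate)
open import Data.Vec.Properties
  using ( lookup∘tabulate; tabulate∘lookup; lookup-replicate; lookup-zipWith
        ; insertAt-lookup; insertAt-punchIn; []=⇒lookup; lookup⇒[]=)
open import Data.Vec.Relation.Binary.Pointwise.Extensional using (ext; Pointwise-≡⇒≡)
open import Function using (_∘_)
open import Function.Bundles using (_⇔_; mk⇔)
open import Relation.Binary.PropositionalEquality
open import Relation.Nullary using (¬_; yes; no)

open IsMatroid

private
  variable
    m n p : ℕ
    A : Set

lookup-injective : {xs ys : Vec A n} → (∀ i → lookup xs i ≡ lookup ys i) → xs ≡ ys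
lookup-injective h = Pointwise-≡⇒≡ (ext h)

if-cong₃ : {b b′ : Bool} {x x′ y y′ : A} → b ≡ b′ → x ≡ x′ → y ≡ y′ →
          (if b then x else y) ≡ (if b′ then x′ else y′)
if-cong₃ refl refl refl = refl

if-both : (b : Bool) {x y z : A} → x ≡ z → y ≡ z → (if b then x else y) ≡ z
if-both true  x≡z _   = x≡z
if-both false _   y≡z = y≡z

data PunchInView (v : Fin (suc n)) : Fin (suc n) → Set where
  at      : PunchInView v v
  punched : (j : Fin n) → PunchInView v (punchIn v j)

punchInView : (v i : Fin (suc n)) → PunchInView v i
punchInView v i with i ≟ v
... | yes refl = at
... | no i≢v   = subst (PunchInView v) (punchIn-punchOut (i≢v ∘ sym)) (punched _)

insertAt-insertAt : (xs : Vec A n) (u : Fin (suc (suc n))) (v : Fin (suc n)) (a b : A)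
  (v≢u : punchIn u v ≢ u) →
  insertAt (insertAt xs v a) u b ≡ insertAt (insertAt xs (punchOut v≢u) b) (punchIn u v) a
insertAt-insertAt xs       zero    v       a b _   = refl
insertAt-insertAt xs       (suc u) zero    a b _   = refl
insertAt-insertAt (x ∷ xs) (suc u) (suc v) a b v≢u =
  cong (x ∷_) (insertAt-insertAt xs u v a b (v≢u ∘ cong suc))

insertAt-replicate : (x : A) (v : Fin (suc n)) → insertAt (replicate n x) v x ≡ replicate (suc n) x
insertAt-replicate x zero                = refl
insertAt-replicate {n = suc n} x (suc v) = cong (x ∷_) (insertAt-replicate x v)

⁅⁆≡insertAt-⊥ : (v : Fin (suc n)) → ⁅ v ⁆ ≡ insertAt ⊥ v true
⁅⁆≡insertAt-⊥ zero                = refl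
⁅⁆≡insertAt-⊥ {n = suc n} (suc v) = cong (false ∷_) (⁅⁆≡insertAt-⊥ v)

⁅punchIn⁆ : (v : Fin (suc n)) (j : Fin n) → ⁅ punchIn v j ⁆ ≡ insertAt ⁅ j ⁆ v false
⁅punchIn⁆ zero    j       = refl
⁅punchIn⁆ (suc v) zero    = cong (true ∷_) (sym (insertAt-replicate false v))
⁅punchIn⁆ (suc v) (suc j) = cong (false ∷_) (⁅punchIn⁆ v j)

insertAt-∪ : (J K : Subset n) (v : Fin (suc n)) (a b : Bool) →
  insertAt J v a ∪ insertAt K v b ≡ insertAt (J ∪ K) v (a ∨ b)
insertAt-∪ J       K       zero    a b = refl
insertAt-∪ (x ∷ J) (y ∷ K) (suc v) a b = cong ((x ∨ y) ∷_) (insertAt-∪ J K v a b)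

∣insertAt∣ : (J : Subset n) (v : Fin (suc n)) (b : Bool) → ∣ insertAt J v b ∣ ≡ ∣ b ∷ J ∣
∣insertAt∣ J       zero    b = refl
∣insertAt∣ (x ∷ J) (suc v) b with ∣insertAt∣ J v b
∣insertAt∣ (true  ∷ J) (suc v) true  | eq = cong suc eq
∣insertAt∣ (true  ∷ J) (suc v) false | eq = cong suc eq
∣insertAt∣ (false ∷ J) (suc v) true  | eq = eq
∣insertAt∣ (false ∷ J) (suc v) false | eq = eq

module _ {J : Subset n} {v : Fin (suc n)} {b : Bool} where

  ∈-insertAt⁺ : ∀ {j} → j ∈ J → punchIn v j ∈ insertAt J v b
  ∈-insertAt⁺ j∈J = lookup⇒[]= _ _ (trans (insertAt-punchIn J v b _) ([]=⇒lookup j∈J))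

  ∈-insertAt⁻ : ∀ {j} → punchIn v j ∈ insertAt J v b → j ∈ J
  ∈-insertAt⁻ h = lookup⇒[]= _ _ (trans (sym (insertAt-punchIn J v b _)) ([]=⇒lookup h))

  ∈-insertAt-at : {K : Subset n} → v ∈ insertAt K v b → v ∈ insertAt J v b
  ∈-insertAt-at {K} h = lookup⇒[]= _ _ (trans (insertAt-lookup J v b)
    (trans (sym (insertAt-lookup K v b)) ([]=⇒lookup h)))

insertAt-⊆ : {J K : Subset n} (v : Fin (suc n)) (b : Bool) → J ⊆ K → insertAt J v b ⊆ insertAt K v b
insertAt-⊆ v b J⊆K {x} x∈ with punchInView v x
... | at        = ∈-insertAt-at x∈
... | punched j = ∈-insertAt⁺ (J⊆K (∈-insertAt⁻ x∈))

indicator : Subset n → Fin n → ℕ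
indicator J i = if lookup J i then 1 else 0

∣∣≡sum-indicator : (J : Subset n) → ∣ J ∣ ≡ sum (indicator J)
∣∣≡sum-indicator []          = refl
∣∣≡sum-indicator (true ∷ J)  = cong suc (∣∣≡sum-indicator J)
∣∣≡sum-indicator (false ∷ J) = ∣∣≡sum-indicator J

preimage : Permutation m n → Subset n → Subset m
preimage σ J = tabulate (λ i → lookup J (σ ⟨$⟩ʳ i))

module _ (σ : Permutation m n) where

  lookup-preimage : ∀ J i → lookup (preimage σ J) i ≡ lookup J (σ ⟨$⟩ʳ i)
  lookup-preimage J i = lookup∘tabulate _ i

  ∈-preimage⁺ : ∀ {J x} → σ ⟨$⟩ʳ x ∈ J → x ∈ preimage σ J
  ∈-preimage⁺ {J} h = lookup⇒[]= _ _ (trans (lookup-preimage J _) ([]=⇒lookup h))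

  ∈-preimage⁻ : ∀ {J x} → x ∈ preimage σ J → σ ⟨$⟩ʳ x ∈ J
  ∈-preimage⁻ {J} h = lookup⇒[]= _ _ (trans (sym (lookup-preimage J _)) ([]=⇒lookup h))

  preimage-⊥ : preimage σ ⊥ ≡ ⊥
  preimage-⊥ = lookup-injective λ i →
    trans (lookup-preimage ⊥ i) (trans (lookup-replicate (σ ⟨$⟩ʳ i) false) (sym (lookup-replicate i false)))

  preimage-∪ : ∀ J K → preimage σ (J ∪ K) ≡ preimage σ J ∪ preimage σ K
  preimage-∪ J K = lookup-injective λ i → begin
    lookup (preimage σ (J ∪ K)) i                         ≡⟨ lookup-preimage (J ∪ K) i ⟩
    lookup (J ∪ K) (σ ⟨$⟩ʳ i)                             ≡⟨ lookup-zipWith _∨_ (σ ⟨$⟩ʳ i) J K ⟩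
    lookup J (σ ⟨$⟩ʳ i) ∨ lookup K (σ ⟨$⟩ʳ i)             ≡⟨ cong₂ _∨_ (lookup-preimage J i) (lookup-preimage K i) ⟨
    lookup (preimage σ J) i ∨ lookup (preimage σ K) i     ≡⟨ lookup-zipWith _∨_ i (preimage σ J) (preimage σ K) ⟨
    lookup (preimage σ J ∪ preimage σ K) i                ∎
    where open ≡-Reasoning

  ∣preimage∣ : ∀ J → ∣ preimage σ J ∣ ≡ ∣ J ∣
  ∣preimage∣ J = begin
    ∣ preimage σ J ∣                 ≡⟨ ∣∣≡sum-indicator (preimage σ J) ⟩
    sum (indicator (preimage σ J))   ≡⟨ sum-cong-≗ (cong (if_then 1 else 0) ∘ lookup-preimage J) ⟩
    sum (indicator J ∘ (σ ⟨$⟩ʳ_))    ≡⟨ sum-permute (indicator J) σ ⟨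
    sum (indicator J)                ≡⟨ ∣∣≡sum-indicator J ⟨
    ∣ J ∣                            ∎
    where open ≡-Reasoning

preimage-insertAt : (σ : Permutation (suc m) (suc n)) (v : Fin (suc m)) (J : Subset n) (b : Bool) →
  preimage σ (insertAt J (σ ⟨$⟩ʳ v) b) ≡ insertAt (preimage (remove v σ) J) v b
preimage-insertAt σ v J b = lookup-injective λ i → pointwise i (punchInView v i)
  where
  open ≡-Reasoning
  σ′ = remove v σ
  J′ = insertAt J (σ ⟨$⟩ʳ v) b
  pointwise : ∀ i → PunchInView v i → lookup (preimage σ J′) i ≡ lookup (insertAt (preimage σ′ J) v b) i
  pointwise _ at = begin
    lookup (preimage σ J′) v                  ≡⟨ lookup-preimage σ J′ v ⟩
    lookup J′ (σ ⟨$⟩ʳ v)                      ≡⟨ insertAt-lookup J (σ ⟨$⟩ʳ v) b ⟩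
    b                                         ≡⟨ insertAt-lookup (preimage σ′ J) v b ⟨
    lookup (insertAt (preimage σ′ J) v b) v   ∎
  pointwise _ (punched j) = begin
    lookup (preimage σ J′) (punchIn v j)                   ≡⟨ lookup-preimage σ J′ (punchIn v j) ⟩
    lookup J′ (σ ⟨$⟩ʳ punchIn v j)                         ≡⟨ cong (lookup J′) (punchIn-permute σ v j) ⟩
    lookup J′ (punchIn (σ ⟨$⟩ʳ v) (σ′ ⟨$⟩ʳ j))             ≡⟨ insertAt-punchIn J (σ ⟨$⟩ʳ v) b (σ′ ⟨$⟩ʳ j) ⟩
    lookup J (σ′ ⟨$⟩ʳ j)                                   ≡⟨ lookup-preimage σ′ J j ⟨
    lookup (preimage σ′ J) j                               ≡⟨ insertAt-punchIn (preimage σ′ J) v b j ⟨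
    lookup (insertAt (preimage σ′ J) v b) (punchIn v j)    ∎

preimage-⁅⁆ : (σ : Permutation m n) (y : Fin m) → preimage σ ⁅ σ ⟨$⟩ʳ y ⁆ ≡ ⁅ y ⁆
preimage-⁅⁆ {n = zero}  σ y with σ ⟨$⟩ʳ y
... | ()
preimage-⁅⁆ {suc m} {suc n} σ y = begin
  preimage σ ⁅ σ ⟨$⟩ʳ y ⁆                       ≡⟨ cong (preimage σ) (⁅⁆≡insertAt-⊥ (σ ⟨$⟩ʳ y)) ⟩
  preimage σ (insertAt ⊥ (σ ⟨$⟩ʳ y) true)      ≡⟨ preimage-insertAt σ y ⊥ true ⟩
  insertAt (preimage (remove y σ) ⊥) y true    ≡⟨ cong (λ J → insertAt J y true) (preimage-⊥ (remove y σ)) ⟩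
  insertAt ⊥ y true                            ≡⟨ ⁅⁆≡insertAt-⊥ y ⟨
  ⁅ y ⁆                                        ∎
  where open ≡-Reasoning

≗⇒Iso : {M N : Indep n} → (∀ J → N J ≡ M J) → Iso M N
≗⇒Iso {M = M} N≗M = idₚ , λ J → trans (N≗M J) (cong M (sym (tabulate∘lookup J)))

Iso-trans : {M : Indep m} {N : Indep n} {P : Indep p} → Iso M N → Iso N P → Iso M P
Iso-trans {M = M} (σ , f) (τ , g) = σ ∘ₚ τ , λ J → trans (g J) (trans (f (preimage τ J))
  (cong M (lookup-injective λ i → trans (lookup-preimage σ (preimage τ J) i)
    (trans (lookup-preimage τ J (σ ⟨$⟩ʳ i)) (sym (lookup-preimage (σ ∘ₚ τ) J i))))))

Iso-sym : {M : Indep m} {N : Indep n} → Iso M N → Iso N M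
Iso-sym {M = M} (σ , f) = flip σ , λ K → sym (trans (f (preimage (flip σ) K))
  (cong M (lookup-injective λ i → trans (lookup-preimage σ (preimage (flip σ) K) i)
    (trans (lookup-preimage (flip σ) K (σ ⟨$⟩ʳ i)) (cong (lookup K) (inverseˡ σ))))))

Iso-delete : {M : Indep (suc m)} {N : Indep (suc n)} ((σ , _) : Iso M N) (v : Fin (suc m)) →
  Iso (delete v M) (delete (σ ⟨$⟩ʳ v) N)
Iso-delete {M = M} (σ , f) v = remove v σ , λ J → trans (f _) (cong M (preimage-insertAt σ v J false))

Iso-nonLoop : {M : Indep m} {N : Indep n} ((σ , _) : Iso M N) (x : Fin m) → N ⁅ σ ⟨$⟩ʳ x ⁆ ≡ M ⁅ x ⁆
Iso-nonLoop {M = M} (σ , f) x = trans (f ⁅ σ ⟨$⟩ʳ x ⁆) (cong M (preimage-⁅⁆ σ x))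

Iso-contract : {M : Indep (suc m)} {N : Indep (suc n)} ((σ , _) : Iso M N) (v : Fin (suc m)) →
  Iso (contract v M) (contract (σ ⟨$⟩ʳ v) N)
Iso-contract {M = M} {N} i@(σ , f) v = remove v σ , λ J →
  if-cong₃ (Iso-nonLoop {M = M} {N = N} i v)
           (trans (f _) (cong M (preimage-insertAt σ v J true)))
           (trans (f _) (cong M (preimage-insertAt σ v J false)))

Iso-deleteˡ : {M : Indep (suc m)} {N : Indep (suc n)} ((σ , _) : Iso M N) (v : Fin (suc n)) →
  Iso (delete (σ ⟨$⟩ˡ v) M) (delete v N)
Iso-deleteˡ {M = M} {N} i@(σ , _) v =
  subst (λ w → Iso (delete (σ ⟨$⟩ˡ v) M) (delete w N)) (inverseʳ σ) (Iso-delete {M = M} {N = N} i (σ ⟨$⟩ˡ v))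

Iso-contractˡ : {M : Indep (suc m)} {N : Indep (suc n)} ((σ , _) : Iso M N) (v : Fin (suc n)) →
  Iso (contract (σ ⟨$⟩ˡ v) M) (contract v N)
Iso-contractˡ {M = M} {N} i@(σ , _) v =
  subst (λ w → Iso (contract (σ ⟨$⟩ˡ v) M) (contract w N)) (inverseʳ σ) (Iso-contract {M = M} {N = N} i (σ ⟨$⟩ˡ v))

Iso-isMatroid : {M : Indep m} {N : Indep n} → Iso M N → IsMatroid M → IsMatroid N
Iso-isMatroid {M = M} (σ , f) mM .empty-indep =
  trans (f ⊥) (trans (cong M (preimage-⊥ σ)) (mM .empty-indep))
Iso-isMatroid (σ , f) mM .down-closed J K J⊆K NK =
  trans (f J) (mM .down-closed (preimage σ J) (preimage σ K)
    (∈-preimage⁺ σ ∘ J⊆K ∘ ∈-preimage⁻ σ) (trans (sym (f K)) NK))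
Iso-isMatroid {M = M} (σ , f) mM .augment J K NJ NK ∣J∣<∣K∣
  with mM .augment (preimage σ J) (preimage σ K) (trans (sym (f J)) NJ) (trans (sym (f K)) NK)
         (subst₂ _<_ (sym (∣preimage∣ σ J)) (sym (∣preimage∣ σ K)) ∣J∣<∣K∣)
... | y , y∈K , y∉J , MJy = σ ⟨$⟩ʳ y , ∈-preimage⁻ σ y∈K , y∉J ∘ ∈-preimage⁺ σ , (begin
  _                                            ≡⟨ f (J ∪ ⁅ σ ⟨$⟩ʳ y ⁆) ⟩
  M (preimage σ (J ∪ ⁅ σ ⟨$⟩ʳ y ⁆))            ≡⟨ cong M (preimage-∪ σ J ⁅ σ ⟨$⟩ʳ y ⁆) ⟩
  M (preimage σ J ∪ preimage σ ⁅ σ ⟨$⟩ʳ y ⁆)   ≡⟨ cong (M ∘ (preimage σ J ∪_)) (preimage-⁅⁆ σ y) ⟩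
  M (preimage σ J ∪ ⁅ y ⁆)                     ≡⟨ MJy ⟩
  true                                         ∎)
  where open ≡-Reasoning

Minor-respʳ-Iso : {L : Indep p} {M : Indep m} {N : Indep n} → Minor L M → Iso M N → Minor L N
Minor-respʳ-Iso {L = L} {M} (iso i) j = iso (Iso-trans {M = L} {N = M} i j)
Minor-respʳ-Iso {n = zero}  (del v _) (σ , _) with σ ⟨$⟩ʳ zero
... | ()
Minor-respʳ-Iso {n = zero}  (con v _) (σ , _) with σ ⟨$⟩ʳ zero
... | ()
Minor-respʳ-Iso {n = suc n} {M = M} {N = N} (del v L≤M) j@(σ , _) =
  del (σ ⟨$⟩ʳ v) (Minor-respʳ-Iso L≤M (Iso-delete {M = M} {N = N} j v))
Minor-respʳ-Iso {n = suc n} {M = M} {N = N} (con v L≤M) j@(σ , _) =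
  con (σ ⟨$⟩ʳ v) (Minor-respʳ-Iso L≤M (Iso-contract {M = M} {N = N} j v))

Minor-trans : {L : Indep p} {M : Indep m} {N : Indep n} → Minor L M → Minor M N → Minor L N
Minor-trans L≤M (iso i)     = Minor-respʳ-Iso L≤M i
Minor-trans L≤M (del v M≤N) = del v (Minor-trans L≤M M≤N)
Minor-trans L≤M (con v M≤N) = con v (Minor-trans L≤M M≤N)

Minor-refl : {M : Indep n} → Minor M M
Minor-refl = iso (≗⇒Iso λ _ → refl)

Minor-respʳ-≗ : {L : Indep m} {M N : Indep n} → (∀ J → N J ≡ M J) → Minor L M → Minor L N
Minor-respʳ-≗ N≗M L≤M = Minor-respʳ-Iso L≤M (≗⇒Iso N≗M)

Minor-respˡ-≗ : {L L′ : Indep m} {N : Indep n} → (∀ J → L J ≡ L′ J) → Minor L N → Minor L′ N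
Minor-respˡ-≗ L≗L′ L≤N = Minor-trans (iso (≗⇒Iso L≗L′)) L≤N

¬Minor-of-empty : {M : Indep (suc m)} {N : Indep 0} → ¬ Minor M N
¬Minor-of-empty (iso (σ , _)) with σ ⟨$⟩ʳ zero
... | ()

∣∷∣-mono-< : (b : Bool) {J K : Subset n} → ∣ J ∣ < ∣ K ∣ → ∣ b ∷ J ∣ < ∣ b ∷ K ∣
∣∷∣-mono-< true  = s≤s
∣∷∣-mono-< false = λ ∣J∣<∣K∣ → ∣J∣<∣K∣

insertAt-isMatroid : {M : Indep (suc n)} (v : Fin (suc n)) (b : Bool) → IsMatroid M →
  M (insertAt ⊥ v b) ≡ true → IsMatroid (λ J → M (insertAt J v b))
insertAt-isMatroid v b mM M⊥ .empty-indep = M⊥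
insertAt-isMatroid v b mM M⊥ .down-closed J K J⊆K = mM .down-closed _ _ (insertAt-⊆ v b J⊆K)
insertAt-isMatroid {M = M} v b mM M⊥ .augment J K MJ MK ∣J∣<∣K∣
  with mM .augment (insertAt J v b) (insertAt K v b) MJ MK
         (subst₂ _<_ (sym (∣insertAt∣ J v b)) (sym (∣insertAt∣ K v b)) (∣∷∣-mono-< b {J} {K} ∣J∣<∣K∣))
... | x , x∈K , x∉J , MJx with punchInView v x
...   | at        = ⊥-elim (x∉J (∈-insertAt-at x∈K))
...   | punched j = j , ∈-insertAt⁻ x∈K , x∉J ∘ ∈-insertAt⁺ , trans (cong M J∪j) MJx
  where
  open ≡-Reasoning
  J∪j : insertAt (J ∪ ⁅ j ⁆) v b ≡ insertAt J v b ∪ ⁅ punchIn v j ⁆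
  J∪j = begin
    insertAt (J ∪ ⁅ j ⁆) v b                  ≡⟨ cong (insertAt (J ∪ ⁅ j ⁆) v) (∨-identityʳ b) ⟨
    insertAt (J ∪ ⁅ j ⁆) v (b ∨ false)        ≡⟨ insertAt-∪ J ⁅ j ⁆ v b false ⟨
    insertAt J v b ∪ insertAt ⁅ j ⁆ v false   ≡⟨ cong (insertAt J v b ∪_) (⁅punchIn⁆ v j) ⟨
    insertAt J v b ∪ ⁅ punchIn v j ⁆          ∎

delete-isMatroid : {M : Indep (suc n)} (v : Fin (suc n)) → IsMatroid M → IsMatroid (delete v M)
delete-isMatroid {M = M} v mM =
  insertAt-isMatroid v false mM (trans (cong M (insertAt-replicate false v)) (mM .empty-indep))

contract-isMatroid : {M : Indep (suc n)} (v : Fin (suc n)) → IsMatroid M → IsMatroid (contract v M)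
contract-isMatroid {M = M} v mM with M ⁅ v ⁆ in Mv
... | true  = insertAt-isMatroid v true mM (trans (cong M (sym (⁅⁆≡insertAt-⊥ v))) Mv)
... | false = delete-isMatroid v mM

Minor-isMatroid : {M : Indep m} {N : Indep n} → Minor M N → IsMatroid N → IsMatroid M
Minor-isMatroid {M = M} {N} (iso i) mN = Iso-isMatroid (Iso-sym {M = M} {N = N} i) mN
Minor-isMatroid (del v M≤N) mN = Minor-isMatroid M≤N (delete-isMatroid v mN)
Minor-isMatroid (con v M≤N) mN = Minor-isMatroid M≤N (contract-isMatroid v mN)

indep⇒nonLoop : {M : Indep n} {J : Subset n} {x : Fin n} →
  IsMatroid M → x ∈ J → M J ≡ true → M ⁅ x ⁆ ≡ true
indep⇒nonLoop mM x∈J = mM .down-closed _ _ λ y∈⁅x⁆ → subst (_∈ _) (sym (x∈⁅y⁆⇒x≡y _ y∈⁅x⁆)) x∈J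

contract-at-nonLoop : {M : Indep (suc n)} {v : Fin (suc n)} → M ⁅ v ⁆ ≡ true →
  ∀ J → contract v M J ≡ M (insertAt J v true)
contract-at-nonLoop {M = M} {v} Mv J =
  cong (λ b → if b then M (insertAt J v true) else M (insertAt J v false)) Mv

-- u and v are distinct elements of Y; w is the index of v in Y - u and u′ that of u in Y - v.
module Swap {Y : Indep (suc (suc n))} (u : Fin (suc (suc n))) (w : Fin (suc n)) where

  v : Fin (suc (suc n))
  v = punchIn u w

  u′ : Fin (suc n)
  u′ = punchOut (punchInᵢ≢i u w)

  private
    swap : ∀ J (a b : Bool) → insertAt (insertAt J w a) u b ≡ insertAt (insertAt J u′ b) v a
    swap J a b = insertAt-insertAt J u w a b (punchInᵢ≢i u w)

    pair : insertAt ⁅ u′ ⁆ v true ≡ insertAt ⁅ w ⁆ u true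
    pair = begin
      insertAt ⁅ u′ ⁆ v true                   ≡⟨ cong (λ J → insertAt J v true) (⁅⁆≡insertAt-⊥ u′) ⟩
      insertAt (insertAt ⊥ u′ true) v true     ≡⟨ swap ⊥ true true ⟨
      insertAt (insertAt ⊥ w true) u true      ≡⟨ cong (λ J → insertAt J u true) (⁅⁆≡insertAt-⊥ w) ⟨
      insertAt ⁅ w ⁆ u true                    ∎
      where open ≡-Reasoning

    ⁅u⁆ : insertAt ⁅ u′ ⁆ v false ≡ ⁅ u ⁆
    ⁅u⁆ = trans (sym (⁅punchIn⁆ v u′)) (cong ⁅_⁆ (punchIn-punchOut (punchInᵢ≢i u w)))

  delete-nonLoop : delete u Y ⁅ w ⁆ ≡ Y ⁅ v ⁆
  delete-nonLoop = cong Y (sym (⁅punchIn⁆ u w))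

  contract-nonLoop : IsMatroid Y → contract u Y ⁅ w ⁆ ≡ true → Y ⁅ v ⁆ ≡ true
  contract-nonLoop mY Y/u-w with Y ⁅ u ⁆
  ... | true  = indep⇒nonLoop mY (∈-insertAt⁺ (x∈⁅x⁆ w)) Y/u-w
  ... | false = trans (sym delete-nonLoop) Y/u-w

  delete-delete : ∀ J → delete u′ (delete v Y) J ≡ delete w (delete u Y) J
  delete-delete J = cong Y (sym (swap J false false))

  delete-contract : ∀ J → delete u′ (contract v Y) J ≡ contract w (delete u Y) J
  delete-contract J =
    if-cong₃ (sym delete-nonLoop) (cong Y (sym (swap J true false))) (cong Y (sym (swap J false false)))

  contract-delete : ∀ J → contract u′ (delete v Y) J ≡ delete w (contract u Y) J
  contract-delete J =
    if-cong₃ (cong Y ⁅u⁆) (cong Y (sym (swap J false true))) (cong Y (sym (swap J false false)))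

  -- As v is not a loop of Y / u, the set {u} is independent exactly when {u, v} is.
  contract-contract : IsMatroid Y → contract u Y ⁅ w ⁆ ≡ true →
    ∀ J → contract u′ (contract v Y) J ≡ contract w (contract u Y) J
  contract-contract mY Y/u-w J = begin
    contract u′ (contract v Y) J
      ≡⟨ if-cong₃ (Y/v ⁅ u′ ⁆) (Y/v _) (Y/v _) ⟩
    (if Y (insertAt ⁅ u′ ⁆ v true) then Y (insertAt (insertAt J u′ true) v true)
                                   else Y (insertAt (insertAt J u′ false) v true))
      ≡⟨ if-cong₃ (trans (cong Y pair) (sym Yu≡Yuv)) (cong Y (sym (swap J true true)))
                                                      (cong Y (sym (swap J true false))) ⟩
    contract u Y (insertAt J w true)
      ≡⟨ contract-at-nonLoop {M = contract u Y} Y/u-w J ⟨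
    contract w (contract u Y) J
      ∎
    where
    open ≡-Reasoning
    Y/v : ∀ X → contract v Y X ≡ Y (insertAt X v true)
    Y/v = contract-at-nonLoop {M = Y} (contract-nonLoop mY Y/u-w)
    Yu≡Yuv : Y ⁅ u ⁆ ≡ Y (insertAt ⁅ w ⁆ u true)
    Yu≡Yuv with Y ⁅ u ⁆ in Yu
    ... | true  = sym Y/u-w
    ... | false with Y (insertAt ⁅ w ⁆ u true) in Yuv
    ...   | false = refl
    ...   | true  = trans (sym Yu) (indep⇒nonLoop mY (lookup⇒[]= u _ (insertAt-lookup ⁅ w ⁆ u true)) Yuv)

Minor-nonLoop : {M : Indep (suc m)} {Y : Indep (suc n)} → IsMatroid Y → Minor M Y →
  (x : Fin (suc m)) → M ⁅ x ⁆ ≡ true →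
  ∃ λ v → Y ⁅ v ⁆ ≡ true × Minor (delete x M) (delete v Y) × Minor (contract x M) (contract v Y)
Minor-nonLoop {M = M} {Y} mY (iso i@(σ , _)) x Mx =
  σ ⟨$⟩ʳ x , trans (Iso-nonLoop {M = M} {N = Y} i x) Mx ,
  iso (Iso-delete {M = M} {N = Y} i x) , iso (Iso-contract {M = M} {N = Y} i x)
Minor-nonLoop {n = zero} mY (del u M≤Y) x Mx = ⊥-elim (¬Minor-of-empty M≤Y)
Minor-nonLoop {n = zero} mY (con u M≤Y) x Mx = ⊥-elim (¬Minor-of-empty M≤Y)
Minor-nonLoop {n = suc n} {Y = Y} mY (del u M≤Y-u) x Mx
  with Minor-nonLoop (delete-isMatroid u mY) M≤Y-u x Mx
... | w , Y-u-w , M-x≤ , M/x≤ =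
  v , trans (sym delete-nonLoop) Y-u-w ,
  del u′ (Minor-respʳ-≗ delete-delete M-x≤) , del u′ (Minor-respʳ-≗ delete-contract M/x≤)
  where open Swap {Y = Y} u w
Minor-nonLoop {n = suc n} {Y = Y} mY (con u M≤Y/u) x Mx
  with Minor-nonLoop (contract-isMatroid u mY) M≤Y/u x Mx
... | w , Y/u-w , M-x≤ , M/x≤ =
  v , contract-nonLoop mY Y/u-w ,
  con u′ (Minor-respʳ-≗ contract-delete M-x≤) ,
  con u′ (Minor-respʳ-≗ (contract-contract mY Y/u-w) M/x≤)
  where open Swap {Y = Y} u w

Augmentation : Indep n → Subset n → Subset n → Set
Augmentation N J K = ∃ λ x → x ∈ K × x ∉ J × N (J ∪ ⁅ x ⁆) ≡ true

Augmentation-plusColoop : {N : Indep n} {J K : Subset n} {b c : Bool} →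
  Augmentation N J K → Augmentation (plusColoop N) (b ∷ J) (c ∷ K)
Augmentation-plusColoop (x , x∈K , x∉J , NJx) = suc x , there x∈K , x∉J ∘ drop-there , NJx

plusColoop-isMatroid : {N : Indep n} → IsMatroid N → IsMatroid (plusColoop N)
plusColoop-isMatroid mN .empty-indep = mN .empty-indep
plusColoop-isMatroid mN .down-closed (_ ∷ J) (_ ∷ K) J⊆K = mN .down-closed J K (drop-∷-⊆ J⊆K)
plusColoop-isMatroid {N = N} mN .augment (false ∷ J) (true ∷ K) NJ _ _ =
  zero , here , (λ ()) , trans (cong N (∪-identityʳ J)) NJ
plusColoop-isMatroid mN .augment (true ∷ J) (true ∷ K) NJ NK (s≤s ∣J∣<∣K∣) =
  Augmentation-plusColoop (mN .augment J K NJ NK ∣J∣<∣K∣)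
plusColoop-isMatroid mN .augment (false ∷ J) (false ∷ K) NJ NK ∣J∣<∣K∣ =
  Augmentation-plusColoop (mN .augment J K NJ NK ∣J∣<∣K∣)
plusColoop-isMatroid mN .augment (true ∷ J) (false ∷ K) NJ NK ∣J∣<∣K∣ =
  Augmentation-plusColoop (mN .augment J K NJ NK (<-trans (n<1+n _) ∣J∣<∣K∣))

plusColoop-isMatroid⁻ : {N : Indep n} → IsMatroid (plusColoop N) → IsMatroid N
plusColoop-isMatroid⁻ = delete-isMatroid zero

delete-plusColoop : {N : Indep (suc n)} (v : Fin (suc n)) →
  ∀ J → delete (suc v) (plusColoop N) J ≡ plusColoop (delete v N) J
delete-plusColoop v (_ ∷ J) = refl

contract-plusColoop : {N : Indep (suc n)} (v : Fin (suc n)) →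
  ∀ J → contract (suc v) (plusColoop N) J ≡ plusColoop (contract v N) J
contract-plusColoop v (_ ∷ J) = refl

Minor-plusColoop : {M : Indep m} {N : Indep n} → Minor M N → Minor (plusColoop M) (plusColoop N)
Minor-plusColoop (iso (σ , f)) = iso (lift₀ σ , λ { (_ ∷ J) → f J })
Minor-plusColoop (del v M≤N) = del (suc v) (Minor-respʳ-≗ (delete-plusColoop v) (Minor-plusColoop M≤N))
Minor-plusColoop (con v M≤N) = con (suc v) (Minor-respʳ-≗ (contract-plusColoop v) (Minor-plusColoop M≤N))

-- W is X ⊕ e only up to ≗ so that deleting or contracting suc w keeps this shape.
Minor-of-plusColoop : {M : Indep m} {W : Indep (suc n)} {X : Indep n} →
  (∀ J → W J ≡ plusColoop X J) → Minor M W →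
  Minor M X ⊎ Σ[ p ∈ ℕ ] Σ[ Y ∈ Indep p ] Minor Y X × Iso M (plusColoop Y)
Minor-of-plusColoop {M = M} {W} {X} W≗X⊕e (iso i) =
  inj₂ (_ , X , Minor-refl , Iso-trans {M = M} {N = W} i (≗⇒Iso (sym ∘ W≗X⊕e)))
Minor-of-plusColoop W≗X⊕e (del zero M≤X) = inj₁ (Minor-respʳ-≗ (λ J → sym (W≗X⊕e (false ∷ J))) M≤X)
Minor-of-plusColoop {W = W} W≗X⊕e (con zero M≤X) =
  inj₁ (Minor-respʳ-≗ (λ J → sym (if-both (W ⁅ zero ⁆) (W≗X⊕e (true ∷ J)) (W≗X⊕e (false ∷ J)))) M≤X)
Minor-of-plusColoop {n = suc n} {W = W} W≗X⊕e (del (suc w) M≤W-w)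
  with Minor-of-plusColoop (λ { (c ∷ J) → W≗X⊕e (c ∷ insertAt J w false) }) M≤W-w
... | inj₁ M≤X-w              = inj₁ (del w M≤X-w)
... | inj₂ (_ , Y , Y≤X-w , i) = inj₂ (_ , Y , del w Y≤X-w , i)
Minor-of-plusColoop {n = suc n} {W = W} W≗X⊕e (con (suc w) M≤W/w)
  with Minor-of-plusColoop (λ { (c ∷ J) → if-cong₃ (W≗X⊕e (false ∷ ⁅ w ⁆)) (W≗X⊕e (c ∷ insertAt J w true))
                                                                          (W≗X⊕e (c ∷ insertAt J w false)) }) M≤W/w
... | inj₁ M≤X/w              = inj₁ (con w M≤X/w)
... | inj₂ (_ , Y , Y≤X/w , i) = inj₂ (_ , Y , con w Y≤X/w , i)

ProperMinor-plusColoop⁺ : {M : Indep m} {N : Indep n} → ProperMinor M N → ProperMinor (plusColoop M) (plusColoop N)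
ProperMinor-plusColoop⁺ {n = suc n} (v , inj₁ M≤N-v) =
  suc v , inj₁ (Minor-respʳ-≗ (delete-plusColoop v) (Minor-plusColoop M≤N-v))
ProperMinor-plusColoop⁺ {n = suc n} (v , inj₂ M≤N/v) =
  suc v , inj₂ (Minor-respʳ-≗ (contract-plusColoop v) (Minor-plusColoop M≤N/v))

ProperMinor-plusColoop⁻ : {M : Indep m} {N : Indep n} → ProperMinor M (plusColoop N) →
  Minor M N ⊎ Σ[ p ∈ ℕ ] Σ[ Y ∈ Indep p ] ProperMinor Y N × Iso M (plusColoop Y)
ProperMinor-plusColoop⁻ (zero , inj₁ M≤N) = inj₁ M≤N
ProperMinor-plusColoop⁻ {N = N} (zero , inj₂ M≤N) = inj₁ (Minor-respʳ-≗ (λ J → sym (if-both (N ⊥) refl refl)) M≤N)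
ProperMinor-plusColoop⁻ {n = suc n} (suc w , inj₁ M≤N-w)
  with Minor-of-plusColoop (delete-plusColoop w) M≤N-w
... | inj₁ M≤X                 = inj₁ (del w M≤X)
... | inj₂ (_ , Y , Y≤N-w , i) = inj₂ (_ , Y , (w , inj₁ Y≤N-w) , i)
ProperMinor-plusColoop⁻ {n = suc n} (suc w , inj₂ M≤N/w)
  with Minor-of-plusColoop (contract-plusColoop w) M≤N/w
... | inj₁ M≤X                 = inj₁ (con w M≤X)
... | inj₂ (_ , Y , Y≤N/w , i) = inj₂ (_ , Y , (w , inj₂ Y≤N/w) , i)

isEmpty-⊥ : ∀ n → isEmpty (⊥ {n}) ≡ true
isEmpty-⊥ zero    = refl
isEmpty-⊥ (suc n) = isEmpty-⊥ n

isEmpty-⁅⁆ : (x : Fin n) → isEmpty ⁅ x ⁆ ≡ false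
isEmpty-⁅⁆ zero    = refl
isEmpty-⁅⁆ (suc x) = isEmpty-⁅⁆ x

UkkPlusU0l-⊥ : ∀ k l → UkkPlusU0l k l ⊥ ≡ true
UkkPlusU0l-⊥ zero    l = isEmpty-⊥ l
UkkPlusU0l-⊥ (suc k) l = UkkPlusU0l-⊥ k l

UkkPlusU0l-suc : ∀ k l J → UkkPlusU0l (suc k) l J ≡ plusColoop (UkkPlusU0l k l) J
UkkPlusU0l-suc k l (_ ∷ J) = refl

delete-nonLoop-UkkPlusU0l : ∀ k l (u : Fin (suc k + l)) → UkkPlusU0l (suc k) l ⁅ u ⁆ ≡ true →
  ∀ J → delete u (UkkPlusU0l (suc k) l) J ≡ UkkPlusU0l k l J
delete-nonLoop-UkkPlusU0l zero    l zero    _ J       = refl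
delete-nonLoop-UkkPlusU0l zero    l (suc u) U⁅u⁆ J    with trans (sym U⁅u⁆) (isEmpty-⁅⁆ u)
... | ()
delete-nonLoop-UkkPlusU0l (suc k) l zero    _ J       = refl
delete-nonLoop-UkkPlusU0l (suc k) l (suc u) U⁅u⁆ (_ ∷ J) = delete-nonLoop-UkkPlusU0l k l u U⁅u⁆ J

Minor-UkkPlusU0l-pred : ∀ k l {Y : Indep n} → Minor (UkkPlusU0l (suc k) l) Y → Minor (UkkPlusU0l k l) Y
Minor-UkkPlusU0l-pred k l = Minor-trans (del zero Minor-refl)

Uniform-suc : ∀ k l {Y : Indep n} → Uniform k l Y → Uniform (suc k) l Y
Uniform-suc k l Y-unif = Y-unif ∘ Minor-UkkPlusU0l-pred k l

Uniform-respʳ-≗ : ∀ k l {M N : Indep n} → (∀ J → N J ≡ M J) → Uniform k l N → Uniform k l M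
Uniform-respʳ-≗ k l N≗M N-unif = N-unif ∘ Minor-respʳ-≗ N≗M

Uniform-resp-Iso : ∀ k l {M : Indep m} {N : Indep n} → Iso M N → Uniform k l M → Uniform k l N
Uniform-resp-Iso k l {M} {N} i M-unif U≤N = M-unif (Minor-respʳ-Iso U≤N (Iso-sym {M = M} {N = N} i))

Uniform-plusColoop⁻ : ∀ k l {Y : Indep n} → Uniform (suc k) l (plusColoop Y) → Uniform k l Y
Uniform-plusColoop⁻ k l Y⊕e-unif = Y⊕e-unif ∘ Minor-respˡ-≗ (sym ∘ UkkPlusU0l-suc k l) ∘ Minor-plusColoop

Uniform-plusColoop : ∀ k l {Z : Indep n} → IsMatroid Z → Uniform k l Z → Uniform (suc k) l (plusColoop Z)
Uniform-plusColoop k l {Z} mZ Z-unif U≤Z⊕e with Minor-of-plusColoop (λ _ → refl) U≤Z⊕e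
... | inj₁ U≤Z = Z-unif (Minor-UkkPlusU0l-pred k l U≤Z)
... | inj₂ (_ , Y , Y≤Z , i@(σ , _)) = Z-unif (Minor-trans (iso Uₖ≅Y) Y≤Z)
  where
  U = UkkPlusU0l (suc k) l
  u = σ ⟨$⟩ˡ zero
  U⁅u⁆ : U ⁅ u ⁆ ≡ true
  U⁅u⁆ = begin
    U ⁅ u ⁆                          ≡⟨ Iso-nonLoop {M = U} {N = plusColoop Y} i u ⟨
    plusColoop Y ⁅ σ ⟨$⟩ʳ u ⁆        ≡⟨ cong (λ x → plusColoop Y ⁅ x ⁆) (inverseʳ σ) ⟩
    Y ⊥                              ≡⟨ Minor-isMatroid Y≤Z mZ .empty-indep ⟩
    true                             ∎
    where open ≡-Reasoning
  Uₖ≅Y : Iso (UkkPlusU0l k l) Y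
  Uₖ≅Y = Iso-trans {M = UkkPlusU0l k l} {N = delete u U}
           (≗⇒Iso (delete-nonLoop-UkkPlusU0l k l u U⁅u⁆)) (Iso-deleteˡ {M = U} {N = plusColoop Y} i zero)

Minor⇒¬AlmostUniform : ∀ k l {Y : Indep n} → IsMatroid Y → Minor (UkkPlusU0l (suc k) l) Y → ¬ AlmostUniform k l Y
Minor⇒¬AlmostUniform {n = zero} k l _ U≤Y _ = ¬Minor-of-empty U≤Y
Minor⇒¬AlmostUniform {n = suc n} k l mY U≤Y Y-au
  with Minor-nonLoop mY U≤Y zero (UkkPlusU0l-⊥ k l)
... | v , _ , Uₖ≤Y-v , U/0≤Y/v with Y-au v
...   | inj₁ Y-v-unif = Y-v-unif Uₖ≤Y-v
...   | inj₂ Y/v-unif = Y/v-unif (Minor-respˡ-≗ U/0≗Uₖ U/0≤Y/v)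
  where
  U/0≗Uₖ : ∀ J → contract zero (UkkPlusU0l (suc k) l) J ≡ UkkPlusU0l k l J
  U/0≗Uₖ = contract-at-nonLoop {M = UkkPlusU0l (suc k) l} {v = zero} (UkkPlusU0l-⊥ k l)

AlmostUniform-suc : ∀ k l {Y : Indep n} → AlmostUniform k l Y → AlmostUniform (suc k) l Y
AlmostUniform-suc {n = zero} k l  _    = tt
AlmostUniform-suc {n = suc n} k l Y-au v with Y-au v
... | inj₁ Y-v-unif = inj₁ (Uniform-suc k l Y-v-unif)
... | inj₂ Y/v-unif = inj₂ (Uniform-suc k l Y/v-unif)

AlmostUniform-resp-Iso : ∀ k l {M : Indep m} {N : Indep n} → Iso M N → AlmostUniform k l M → AlmostUniform k l N
AlmostUniform-resp-Iso {n = zero} k l _ _ = tt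
AlmostUniform-resp-Iso {m = zero} {suc n} k l (σ , _) _ with σ ⟨$⟩ˡ zero
... | ()
AlmostUniform-resp-Iso {m = suc m} {suc n} k l {M} {N} i@(σ , _) M-au v with M-au (σ ⟨$⟩ˡ v)
... | inj₁ unif = inj₁ (Uniform-resp-Iso k l (Iso-deleteˡ {M = M} {N = N} i v) unif)
... | inj₂ unif = inj₂ (Uniform-resp-Iso k l (Iso-contractˡ {M = M} {N = N} i v) unif)

AlmostUniform-plusColoop⁻ : ∀ k l {Y : Indep n} → AlmostUniform (suc k) l (plusColoop Y) → AlmostUniform k l Y
AlmostUniform-plusColoop⁻ {n = zero} k l  _ = tt
AlmostUniform-plusColoop⁻ {n = suc n} k l {Y} Y⊕e-au v with Y⊕e-au (suc v)
... | inj₁ unif = inj₁ (Uniform-plusColoop⁻ k l (Uniform-respʳ-≗ (suc k) l (delete-plusColoop {N = Y} v) unif))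
... | inj₂ unif = inj₂ (Uniform-plusColoop⁻ k l (Uniform-respʳ-≗ (suc k) l (contract-plusColoop {N = Y} v) unif))

AlmostUniform-plusColoop : ∀ k l {Y : Indep n} → IsMatroid Y → AlmostUniform k l Y → AlmostUniform (suc k) l (plusColoop Y)
AlmostUniform-plusColoop k l mY Y-au zero = inj₁ λ U≤Y → Minor⇒¬AlmostUniform k l mY U≤Y Y-au
AlmostUniform-plusColoop {n = suc n} k l {Y} mY Y-au (suc w) with Y-au w
... | inj₁ unif = inj₁ (Uniform-respʳ-≗ (suc k) l (sym ∘ delete-plusColoop {N = Y} w)
                        (Uniform-plusColoop k l (delete-isMatroid w mY) unif))
... | inj₂ unif = inj₂ (Uniform-respʳ-≗ (suc k) l (sym ∘ contract-plusColoop {N = Y} w)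
                        (Uniform-plusColoop k l (contract-isMatroid w mY) unif))

ProperMinorsIn : (∀ {m} → Indep m → Set) → Indep n → Set
ProperMinorsIn C N = ∀ {m} (M : Indep m) → ProperMinor M N → C M

InAlmostUniformClass-suc : ∀ k l {M : Indep n} → InAlmostUniformClass k l M → InAlmostUniformClass (suc k) l M
InAlmostUniformClass-suc k l (mM , M-au) = mM , AlmostUniform-suc k l M-au

InAlmostUniformClass-resp-Iso : ∀ k l {M : Indep m} {N : Indep n} → Iso M N →
  InAlmostUniformClass k l M → InAlmostUniformClass k l N
InAlmostUniformClass-resp-Iso k l i (mM , M-au) = Iso-isMatroid i mM , AlmostUniform-resp-Iso k l i M-au

InAlmostUniformClass-plusColoop : ∀ k l {Y : Indep n} →
  InAlmostUniformClass k l Y → InAlmostUniformClass (suc k) l (plusColoop Y)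
InAlmostUniformClass-plusColoop k l (mY , Y-au) = plusColoop-isMatroid mY , AlmostUniform-plusColoop k l mY Y-au

InAlmostUniformClass-plusColoop⁻ : ∀ k l {Y : Indep n} →
  InAlmostUniformClass (suc k) l (plusColoop Y) → InAlmostUniformClass k l Y
InAlmostUniformClass-plusColoop⁻ k l (mY⊕e , Y⊕e-au) =
  plusColoop-isMatroid⁻ mY⊕e , AlmostUniform-plusColoop⁻ k l Y⊕e-au

AlmostUniform-suc-of-ProperMinors : ∀ k l {N : Indep n} → ProperMinorsIn (InAlmostUniformClass k l) N →
  AlmostUniform (suc k) l N
AlmostUniform-suc-of-ProperMinors {n = zero}  k l _ = tt
AlmostUniform-suc-of-ProperMinors {n = suc n} k l {N} props v = inj₁ λ U≤N-v →
  let mN-v , N-v-au = props (delete v N) (v , inj₁ Minor-refl)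
  in  Minor⇒¬AlmostUniform k l mN-v U≤N-v N-v-au

Minor-InAlmostUniformClass-suc : ∀ k l {M : Indep m} {N : Indep n} → IsMatroid N →
  ProperMinorsIn (InAlmostUniformClass k l) N → Minor M N → InAlmostUniformClass (suc k) l M
Minor-InAlmostUniformClass-suc k l {M} {N} mN props (iso i) =
  InAlmostUniformClass-resp-Iso (suc k) l (Iso-sym {M = M} {N = N} i)
    (mN , AlmostUniform-suc-of-ProperMinors k l props)
Minor-InAlmostUniformClass-suc k l mN props (del w M≤N-w) =
  InAlmostUniformClass-suc k l (props _ (w , inj₁ M≤N-w))
Minor-InAlmostUniformClass-suc k l mN props (con w M≤N/w) =
  InAlmostUniformClass-suc k l (props _ (w , inj₂ M≤N/w))

ExcludedMinor-plusColoop : ∀ k l {N : Indep n} →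
  ExcludedMinor (InAlmostUniformClass k l) N → ExcludedMinor (InAlmostUniformClass (suc k) l) (plusColoop N)
ExcludedMinor-plusColoop k l {N} (mN , N∉ , props) = plusColoop-isMatroid mN , N⊕e∉ , props⊕e
  where
  N⊕e∉ : ¬ InAlmostUniformClass (suc k) l (plusColoop N)
  N⊕e∉ = N∉ ∘ InAlmostUniformClass-plusColoop⁻ k l
  props⊕e : ProperMinorsIn (InAlmostUniformClass (suc k) l) (plusColoop N)
  props⊕e M M<N⊕e with ProperMinor-plusColoop⁻ M<N⊕e
  ... | inj₁ M≤N                    = Minor-InAlmostUniformClass-suc k l mN props M≤N
  ... | inj₂ (_ , Y , Y<N , M≅Y⊕e) =
    InAlmostUniformClass-resp-Iso (suc k) l (Iso-sym {M = M} {N = plusColoop Y} M≅Y⊕e)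
      (InAlmostUniformClass-plusColoop k l (props Y Y<N))

ExcludedMinor-plusColoop⁻ : ∀ k l {N : Indep n} →
  ExcludedMinor (InAlmostUniformClass (suc k) l) (plusColoop N) → ExcludedMinor (InAlmostUniformClass k l) N
ExcludedMinor-plusColoop⁻ k l (mN⊕e , N⊕e∉ , props⊕e) =
  plusColoop-isMatroid⁻ mN⊕e ,
  N⊕e∉ ∘ InAlmostUniformClass-plusColoop k l ,
  λ M M<N → InAlmostUniformClass-plusColoop⁻ k l (props⊕e (plusColoop M) (ProperMinor-plusColoop⁺ M<N))

corollary3p5 : (k l : ℕ) → k ≥ 1 → l ≥ 1 → ∀ {n} (N : Indep n) → IsMatroid N →
    (ExcludedMinor (InAlmostUniformClass k l) N
      ⇔ ExcludedMinor (InAlmostUniformClass (suc k) l) (plusColoop N))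
corollary3p5 k l _ _ N _ = mk⇔ (ExcludedMinor-plusColoop k l) (ExcludedMinor-plusColoop⁻ k l)
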